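{- Let $K$ be a field with a nonarchimedean valuation $\nu:K\to\mathbb{R}\cup\{\infty\}$. There exists a (finite-valued) valuated $\Delta$-matroid $p:\{0,1\}^4\to\mathbb{R}$ with $p_\emptyset=0$ such that there is no $4\times4$ matrix $A$ over $K$ with $\nu(A_S)=p_S$ for all $S\subseteq[4]$.
   Context: $p_S=p(e_S)$ with $e_S=\sum_{i\in S}e_i$. $A_S$ is the determinant of the principal submatrix of $A$ indexed by $S$, with $A_\emptyset=1$. For $p:\{0,1\}^n\to\mathbb{R}$, its induced subdivision is the set of projections (deleting the last coordinate) of the lower faces of $\operatorname{conv}\{(x,p(x))\}\subset\mathbb{R}^{n+1}$ (faces supported by hyperplanes whose inner normal has positive last coordinate); $p$ is a valuated $\Delta$-matroid if every edge of the induced subdivision has length (Hamming distance of endpoints) at most $2$. -}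

module Defs where

open import Level using (Level; _⊔_; 0ℓ) renaming (suc to lsuc)
open import Data.Nat as ℕ using (ℕ; zero; suc)
open import Data.Bool using (Bool; true; false; if_then_else_)
open import Data.Fin using (Fin; zero; suc; punchIn)
open import Data.Vec using (Vec; []; _∷_; replicate)
open import Data.Maybe using (Maybe; just; nothing)
open import Data.Product using (Σ; ∃; _×_; _,_)
open import Data.Sum using (_⊎_)
open import Relation.Nullary using (¬_)
open import Relation.Binary.PropositionalEquality using (_≡_; _≢_)
open import Relation.Binary.Structures using (IsTotalOrder)
open import Algebra.Structures using (IsCommutativeRing)
open import Algebra.Bundles using (CommutativeRing)

-- A model of the real numbers: a complete (Dedekind, least-upper-bound)
-- ordered field.  Any two such are isomorphic, so quantifying over all
-- of them is the same as speaking about ℝ.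

record RealField : Set₁ where
  infixl 6 _+_
  infixl 7 _*_
  infix 4 _≤_ _<_
  field
    Carrier : Set
    _+_ _*_ : Carrier → Carrier → Carrier
    -_      : Carrier → Carrier
    0r 1r   : Carrier
    _≤_     : Carrier → Carrier → Set
    isCommutativeRing : IsCommutativeRing _≡_ _+_ _*_ -_ 0r 1r
    0≢1     : 0r ≢ 1r
    inverse : ∀ x → x ≢ 0r → ∃ λ y → x * y ≡ 1r
    isTotalOrder : IsTotalOrder _≡_ _≤_
    +-mono-≤ : ∀ {x y} z → x ≤ y → x + z ≤ y + z
    *-nonneg : ∀ {x y} → 0r ≤ x → 0r ≤ y → 0r ≤ x * y
    sup : (P : Carrier → Set) → (∃ λ x → P x) →
          (∃ λ b → ∀ x → P x → x ≤ b) →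
          ∃ λ s → (∀ x → P x → x ≤ s) ×
                  (∀ b → (∀ x → P x → x ≤ b) → s ≤ b)

  _<_ : Carrier → Carrier → Set
  x < y = x ≤ y × x ≢ y

record Field (c ℓ : Level) : Set (lsuc (c ⊔ ℓ)) where
  field
    commutativeRing : CommutativeRing c ℓ
  open CommutativeRing commutativeRing public
  field
    0≉1     : ¬ (0# ≈ 1#)
    inverse : ∀ x → ¬ (x ≈ 0#) → ∃ λ y → (x * y) ≈ 1#

-- ℝ ∪ {∞}: nothing = ∞, just r = r.

module _ (R : RealField) where
  open RealField R renaming (Carrier to ℝ)

  R∞ : Set
  R∞ = Maybe ℝ

  _+∞_ : R∞ → R∞ → R∞
  just x +∞ just y = just (x + y)
  _      +∞ _      = nothing

  _≤∞_ : R∞ → R∞ → Set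
  _       ≤∞ nothing = Data.Unit.⊤
    where import Data.Unit
  nothing ≤∞ just _  = Data.Empty.⊥
    where import Data.Empty
  just x  ≤∞ just y  = x ≤ y

  record Valuation {c ℓ} (K : Field c ℓ) : Set (c ⊔ ℓ) where
    open Field K using (_≈_; 0#) renaming (Carrier to |K|; _+_ to _+K_; _*_ to _*K_)
    field
      ν       : |K| → R∞
      ν-cong  : ∀ {a b} → a ≈ b → ν a ≡ ν b
      ν-∞     : ∀ a → ν a ≡ nothing → a ≈ 0#
      ν-0     : ν 0# ≡ nothing
      ν-mult  : ∀ a b → ν (a *K b) ≡ ν a +∞ ν b
      ν-ultra : ∀ a b → (ν a ≤∞ ν (a +K b)) ⊎ (ν b ≤∞ ν (a +K b))

-- Subsets S ⊆ [n] are identified with their indicator vectors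
-- e_S ∈ {0,1}^n, i.e. Vec Bool n.

Cube : ℕ → Set
Cube n = Vec Bool n

∅ : ∀ {n} → Cube n
∅ = replicate _ false

card : ∀ {n} → Cube n → ℕ
card []          = zero
card (true  ∷ s) = suc (card s)
card (false ∷ s) = card s

elems : ∀ {n} (S : Cube n) → Fin (card S) → Fin n
elems (true  ∷ s) zero    = zero
elems (true  ∷ s) (suc i) = suc (elems s i)
elems (false ∷ s) i       = suc (elems s i)

hamming : ∀ {n} → Cube n → Cube n → ℕ
hamming []          []          = zero
hamming (true  ∷ x) (true  ∷ y) = hamming x y
hamming (false ∷ x) (false ∷ y) = hamming x y
hamming (true  ∷ x) (false ∷ y) = suc (hamming x y)
hamming (false ∷ x) (true  ∷ y) = suc (hamming x y)

module Det {c ℓ} (K : CommutativeRing c ℓ) where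
  open CommutativeRing K using (Carrier; _+_; _*_; -_; 1#)

  det : ∀ n → (Fin n → Fin n → Carrier) → Carrier
  det zero    M = 1#
  det (suc n) M = expand n (λ j → M zero j) (λ j r col → M (suc r) (punchIn j col))
    where
    expand : ∀ m → (Fin (suc m) → Carrier) →
             (Fin (suc m) → Fin m → Fin m → Carrier) → Carrier
    expand m a minor = go m a (λ j → det m (minor j))
      where
      go : ∀ k → (Fin (suc k) → Carrier) → (Fin (suc k) → Carrier) → Carrier
      go zero    a d = a zero * d zero
      go (suc k) a d = (a zero * d zero) + (- go k (λ j → a (suc j)) (λ j → d (suc j)))

  principalMinor : ∀ {n} → (Fin n → Fin n → Carrier) → Cube n → Carrier
  principalMinor A S = det (card S) (λ i j → A (elems S i) (elems S j))

-- For p : {0,1}^n → ℝ, lower faces of conv{(x, p x)} are exactly the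
-- faces supported by hyperplanes with inner normal (w, 1), i.e. the
-- convex hulls of the minimiser sets of  x ↦ p x + ⟨w, x⟩,  w ∈ ℝ^n.
-- Since no three points of {0,1}^n are collinear, such a face is an
-- edge iff its minimiser set consists of exactly two points x ≠ y.

module _ (R : RealField) where
  open RealField R renaming (Carrier to ℝ)

  ⟨_,_⟩ : ∀ {n} → (Fin n → ℝ) → Cube n → ℝ
  ⟨_,_⟩ {zero}  w []      = 0r
  ⟨_,_⟩ {suc n} w (b ∷ x) = (if b then w zero else 0r) + ⟨ (λ i → w (suc i)) , x ⟩

  IsLowerEdge : ∀ {n} → (Cube n → ℝ) → (Fin n → ℝ) → Cube n → Cube n → Set
  IsLowerEdge p w x y =
    x ≢ y ×
    (p x + ⟨ w , x ⟩ ≡ p y + ⟨ w , y ⟩) ×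
    (∀ z → z ≢ x → z ≢ y → p x + ⟨ w , x ⟩ < p z + ⟨ w , z ⟩)

  IsValuatedΔMatroid : ∀ {n} → (Cube n → ℝ) → Set
  IsValuatedΔMatroid {n} p =
    ∀ (w : Fin n → ℝ) x y → IsLowerEdge p w x y → hamming x y ℕ.≤ 2

module Submission where

open import Defs
open import Level using (Level)
open import Data.Fin using (Fin)
open import Data.Maybe using (just)
open import Data.Product using (∃; _×_)
open import Relation.Nullary using (¬_)
open import Relation.Binary.PropositionalEquality using (_≡_)

open import Data.Nat as ℕ using (ℕ; zero; suc; z≤n; s≤s; _∸_)
import Data.Nat.Properties as ℕ
open import Data.Nat.ListAction using (sum)
open import Data.Bool as Bool using (Bool; true; false; if_then_else_; _xor_)
open import Data.Fin using (zero; suc; combine; remQuot)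
open import Data.Fin.Patterns using (0F; 1F; 2F; 3F; 4F; 5F; 6F; 7F; 8F)
open import Data.Fin.Subset as Subset using (⁅_⁆; _∪_)
open import Data.Vec as Vec using (Vec; []; _∷_; lookup; tabulate; zipWith)
import Data.Vec.Properties as Vec
open import Data.Vec.Relation.Binary.Pointwise.Inductive using (Pointwise; []; _∷_; tabulate⁺)
import Data.Vec.Relation.Binary.Pointwise.Inductive as Pointwise
open import Data.List as List using (List; []; _∷_; length; map; foldr; filter; allFin; _++_)
open import Data.List.Relation.Unary.All as All using (All; []; _∷_)
open import Data.List.Relation.Unary.Any as Any using (Any)
open import Data.List.Membership.Propositional using (_∈_)
open import Data.List.Membership.Propositional.Properties using (∈-map⁺; ∈-++⁺ˡ; ∈-++⁺ʳ)
open import Data.Maybe using (Maybe; nothing)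
open import Data.Maybe.Properties using (just-injective)
open import Data.Product using (Σ; _,_; proj₁; proj₂; uncurry)
open import Data.Sum using (_⊎_; inj₁; inj₂; [_,_]′)
open import Data.Unit using (⊤; tt)
open import Data.Empty using (⊥-elim)
open import Function using (_∘_)
open import Relation.Nullary using (Dec; yes; no)
open import Relation.Nullary.Decidable using (_×-dec_; _⊎-dec_; ¬?; toWitness; map′)
open import Relation.Unary using (Decidable)
open import Relation.Binary.PropositionalEquality as ≡ using (_≢_; cong; cong₂; subst; subst₂)
open import Relation.Binary.Structures using (IsTotalOrder)
open import Algebra.Bundles using (CommutativeRing; RawRing)
import Algebra.Solver.Ring.AlmostCommutativeRing as ACR
open import Algebra.Morphism.Structures using (IsRingMonomorphism)
import Algebra.Morphism.RingMonomorphism as RingMonomorphism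
import Algebra.Construct.Pointwise as FunctionRing

-- The witness is p_S = 1 for |S| ∈ {2, 4} and p_S = 0 otherwise.
--
-- p is a valuated Δ-matroid by a finite check: for two points x, y at Hamming distance at least 3
-- there is a list of other points with the same coordinate sum as a list of copies of x and y and
-- no larger total p, so no lower supporting hyperplane can cut out the segment [x, y].
--
-- Suppose ν(A_S) = p_S. Rescaling A to L A R by diagonal matrices changes principal minors only by
-- units, and brings A to the normal form with rows (1 1 1 1), (b₁ 1 x y), (b₂ x′ 1 z), (b₃ y′ z′ 1).
-- Its 3×3 minors force all entries to be integral, so it reduces to a matrix over the residue ring
-- 𝒪/𝔪 whose 2×2 principal minors vanish (b_i = 1 and x x′ = y y′ = z z′ = 1) and whose 3×3
-- principal minors are invertible. Up to units these minors are (x - 1)², (y - 1)², (z - 1)² and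
-- (xz - y)², while x y z · det = -(x - 1)(y - 1)(z - 1)(xz - y); so the determinant is invertible
-- modulo 𝔪, contradicting ν(A_[4]) = 1 > 0.

module IntegerRingSolver {c ℓ} (R : CommutativeRing c ℓ) where
  open import Data.Integer as ℤ using (ℤ; +_; -[1+_]; _⊖_; sign; ∣_∣; _◃_)
  import Data.Integer.Properties as ℤ
  open import Data.Sign as Sign using (Sign)
  open CommutativeRing R
  open import Algebra.Properties.Ring ring
  open import Algebra.Properties.Semiring.Mult.TCOptimised semiring
    using (1+×; ×-homo-+; ×1-homo-*) renaming (_×_ to _·_)
  open import Relation.Binary.Reasoning.Setoid setoid

  -- With the type-checker optimised multiple, 1 · 1# is 1# definitionally, so a symbolic
  -- determinant (built with the constant 1) evaluates definitionally to the determinant itself.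
  ⟦_⟧ℤ : ℤ → Carrier
  ⟦ + n ⟧ℤ      = n · 1#
  ⟦ -[1+ n ] ⟧ℤ = - (suc n · 1#)

  private
    signed : Sign → Carrier → Carrier
    signed Sign.+ x = x
    signed Sign.- x = - x

    signed-cong : ∀ s {x y} → x ≈ y → signed s x ≈ signed s y
    signed-cong Sign.+ x≈y = x≈y
    signed-cong Sign.- x≈y = -‿cong x≈y

    signed-* : ∀ s t x y → signed (s Sign.* t) (x * y) ≈ signed s x * signed t y
    signed-* Sign.+ Sign.+ x y = refl
    signed-* Sign.+ Sign.- x y = -‿distribʳ-* x y
    signed-* Sign.- Sign.+ x y = -‿distribˡ-* x y
    signed-* Sign.- Sign.- x y = begin
      x * y         ≈⟨ -‿involutive (x * y) ⟨
      - - (x * y)   ≈⟨ -‿cong (-‿distribʳ-* x y) ⟩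
      - (x * - y)   ≈⟨ -‿distribˡ-* x (- y) ⟩
      - x * - y     ∎

    ◃-semantics : ∀ s n → ⟦ s ◃ n ⟧ℤ ≈ signed s (n · 1#)
    ◃-semantics Sign.+ zero    = refl
    ◃-semantics Sign.- zero    = sym -0#≈0#
    ◃-semantics Sign.+ (suc n) = refl
    ◃-semantics Sign.- (suc n) = refl

    sign-abs-semantics : ∀ i → ⟦ i ⟧ℤ ≈ signed (sign i) (∣ i ∣ · 1#)
    sign-abs-semantics (+ zero)  = refl
    sign-abs-semantics (+ suc n) = refl
    sign-abs-semantics -[1+ n ]  = refl

    ⊖-semantics : ∀ m n → ⟦ m ⊖ n ⟧ℤ ≈ m · 1# - n · 1#
    ⊖-semantics zero    zero    = sym (trans (+-identityˡ _) -0#≈0#)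
    ⊖-semantics zero    (suc n) = sym (+-identityˡ _)
    ⊖-semantics (suc m) zero    = sym (trans (+-congˡ -0#≈0#) (+-identityʳ _))
    ⊖-semantics (suc m) (suc n) = begin
      ⟦ suc m ⊖ suc n ⟧ℤ                ≡⟨ cong ⟦_⟧ℤ (ℤ.[1+m]⊖[1+n]≡m⊖n m n) ⟩
      ⟦ m ⊖ n ⟧ℤ                        ≈⟨ ⊖-semantics m n ⟩
      m · 1# - n · 1#                   ≈⟨ +-congʳ (xyx⁻¹≈y 1# (m · 1#)) ⟨
      (1# + m · 1#) - 1# - n · 1#       ≈⟨ +-assoc _ _ _ ⟩
      (1# + m · 1#) + (- 1# - n · 1#)   ≈⟨ +-congˡ (-‿+-comm 1# (n · 1#)) ⟩
      (1# + m · 1#) - (1# + n · 1#)     ≈⟨ +-cong (1+× m 1#) (-‿cong (1+× n 1#)) ⟨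
      suc m · 1# - suc n · 1#           ∎

  +-homo : ∀ i j → ⟦ i ℤ.+ j ⟧ℤ ≈ ⟦ i ⟧ℤ + ⟦ j ⟧ℤ
  +-homo (+ m)    (+ n)    = ×-homo-+ 1# m n
  +-homo (+ m)    -[1+ n ] = ⊖-semantics m (suc n)
  +-homo -[1+ m ] (+ n)    = trans (⊖-semantics n (suc m)) (+-comm _ _)
  +-homo -[1+ m ] -[1+ n ] = begin
    - (suc (suc (m ℕ.+ n)) · 1#)      ≡⟨ cong (λ k → - (k · 1#)) (ℕ.+-suc (suc m) n) ⟨
    - ((suc m ℕ.+ suc n) · 1#)        ≈⟨ -‿cong (×-homo-+ 1# (suc m) (suc n)) ⟩
    - (suc m · 1# + suc n · 1#)       ≈⟨ -‿+-comm _ _ ⟨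
    - (suc m · 1#) + - (suc n · 1#)   ∎

  *-homo : ∀ i j → ⟦ i ℤ.* j ⟧ℤ ≈ ⟦ i ⟧ℤ * ⟦ j ⟧ℤ
  *-homo i j = begin
    ⟦ (sign i Sign.* sign j) ◃ (∣ i ∣ ℕ.* ∣ j ∣) ⟧ℤ
      ≈⟨ ◃-semantics _ (∣ i ∣ ℕ.* ∣ j ∣) ⟩
    signed (sign i Sign.* sign j) ((∣ i ∣ ℕ.* ∣ j ∣) · 1#)
      ≈⟨ signed-cong (sign i Sign.* sign j) (×1-homo-* ∣ i ∣ ∣ j ∣) ⟩
    signed (sign i Sign.* sign j) ((∣ i ∣ · 1#) * (∣ j ∣ · 1#))
      ≈⟨ signed-* (sign i) (sign j) _ _ ⟩
    signed (sign i) (∣ i ∣ · 1#) * signed (sign j) (∣ j ∣ · 1#)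
      ≈⟨ *-cong (sign-abs-semantics i) (sign-abs-semantics j) ⟨
    ⟦ i ⟧ℤ * ⟦ j ⟧ℤ ∎

  -‿homo : ∀ i → ⟦ ℤ.- i ⟧ℤ ≈ - ⟦ i ⟧ℤ
  -‿homo (+ zero)  = sym -0#≈0#
  -‿homo (+ suc n) = refl
  -‿homo -[1+ n ]  = sym (-‿involutive _)

  ℤ-morphism : ℤ.+-*-rawRing ACR.-Raw-AlmostCommutative⟶ ACR.fromCommutativeRing R
  ℤ-morphism = record
    { ⟦_⟧    = ⟦_⟧ℤ
    ; +-homo = +-homo
    ; *-homo = *-homo
    ; -‿homo = -‿homo
    ; 0-homo = refl
    ; 1-homo = refl
    }

  _≟ℤ_ : ∀ i j → Maybe (⟦ i ⟧ℤ ≈ ⟦ j ⟧ℤ)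
  i ≟ℤ j with i ℤ.≟ j
  ... | yes ≡.refl = just refl
  ... | no _       = nothing

  open import Algebra.Solver.Ring ℤ.+-*-rawRing (ACR.fromCommutativeRing R) ℤ-morphism _≟ℤ_ public

  ⟦⟧-cong : ∀ {m} (e : Polynomial m) {ρ ρ′} → Pointwise _≈_ ρ ρ′ → ⟦ e ⟧ ρ ≈ ⟦ e ⟧ ρ′
  ⟦⟧-cong (op [+] e f) ρ≈ρ′ = +-cong (⟦⟧-cong e ρ≈ρ′) (⟦⟧-cong f ρ≈ρ′)
  ⟦⟧-cong (op [*] e f) ρ≈ρ′ = *-cong (⟦⟧-cong e ρ≈ρ′) (⟦⟧-cong f ρ≈ρ′)
  ⟦⟧-cong (con k)      ρ≈ρ′ = refl
  ⟦⟧-cong (var i)      ρ≈ρ′ = Pointwise.lookup ρ≈ρ′ i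
  ⟦⟧-cong (e :^ k)     ρ≈ρ′ = ^-congˡ k (⟦⟧-cong e ρ≈ρ′)
    where open import Algebra.Properties.Semiring.Exp semiring using (^-congˡ)
  ⟦⟧-cong (:- e)       ρ≈ρ′ = -‿cong (⟦⟧-cong e ρ≈ρ′)

  -- The ring over which Det computes symbolic determinants.
  module _ (m : ℕ) where
    private
      polynomialRawRing : RawRing _ _
      polynomialRawRing = record
        { Carrier = Polynomial m
        ; _≈_ = λ e f → ∀ ρ → ⟦ e ⟧ ρ ≈ ⟦ f ⟧ ρ
        ; _+_ = _:+_ ; _*_ = _:*_ ; -_ = :-_ ; 0# = con (+ 0) ; 1# = con (+ 1)
        }

      functionRing : CommutativeRing _ _
      functionRing = FunctionRing.commutativeRing (Vec Carrier m) R

      ⟦⟧-isRingMonomorphism : IsRingMonomorphism polynomialRawRing (CommutativeRing.rawRing functionRing) ⟦_⟧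
      ⟦⟧-isRingMonomorphism = record
        { isRingHomomorphism = record
          { isSemiringHomomorphism = record
            { isNearSemiringHomomorphism = record
              { +-isMonoidHomomorphism = record
                { isMagmaHomomorphism = record
                  { isRelHomomorphism = record { cong = λ e≈f → e≈f }
                  ; homo = λ _ _ _ → refl
                  }
                ; ε-homo = λ _ → refl
                }
              ; *-homo = λ _ _ _ → refl
              }
            ; 1#-homo = λ _ → refl
            }
          ; -‿homo = λ _ _ → refl
          }
        ; injective = λ e≈f → e≈f
        }

    polynomialRing : CommutativeRing _ _
    polynomialRing = record
      { RawRing polynomialRawRing
      ; isCommutativeRing = RingMonomorphism.isCommutativeRing ⟦⟧-isRingMonomorphism
                              (CommutativeRing.isCommutativeRing functionRing)
      }

matrix : ∀ {a} {A : Set a} {k} → Vec (Vec A k) k → Fin k → Fin k → A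
matrix rows i j = lookup (lookup rows i) j

matrix-map : ∀ {a b} {A : Set a} {B : Set b} (f : A → B) {k} (rows : Vec (Vec A k) k) i j →
  f (matrix rows i j) ≡ matrix (Vec.map (Vec.map f) rows) i j
matrix-map f rows i j = ≡.trans (≡.sym (Vec.lookup-map j f (lookup rows i)))
                                (cong (λ row → lookup row j) (≡.sym (Vec.lookup-map i (Vec.map f) rows)))

module Matrices {c ℓ} (R : CommutativeRing c ℓ) where
  open CommutativeRing R hiding (zero)

  ∏ : ∀ {k} → (Fin k → Carrier) → Carrier
  ∏ {zero}  f = 1#
  ∏ {suc k} f = f zero * ∏ (f ∘ suc)

  scale : ∀ {k} → (Fin k → Carrier) → (Fin k → Fin k → Carrier) → (Fin k → Carrier) → Fin k → Fin k → Carrier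
  scale l M r i j = l i * M i j * r j

  unitDiagonal₂ : (a a′ : Carrier) → Fin 2 → Fin 2 → Carrier
  unitDiagonal₂ a a′ = matrix
    ( (1# ∷ a  ∷ [])
    ∷ (a′ ∷ 1# ∷ [])
    ∷ [])

  unitDiagonal₃ : (x y z x′ y′ z′ : Carrier) → Fin 3 → Fin 3 → Carrier
  unitDiagonal₃ x y z x′ y′ z′ = matrix
    ( (1# ∷ x  ∷ y  ∷ [])
    ∷ (x′ ∷ 1# ∷ z  ∷ [])
    ∷ (y′ ∷ z′ ∷ 1# ∷ [])
    ∷ [])

  normalFormRows : (b₁ b₂ b₃ x y z x′ y′ z′ : Carrier) → Vec (Vec Carrier 4) 4
  normalFormRows b₁ b₂ b₃ x y z x′ y′ z′ =
      (1# ∷ 1# ∷ 1# ∷ 1# ∷ [])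
    ∷ (b₁ ∷ 1# ∷ x  ∷ y  ∷ [])
    ∷ (b₂ ∷ x′ ∷ 1# ∷ z  ∷ [])
    ∷ (b₃ ∷ y′ ∷ z′ ∷ 1# ∷ [])
    ∷ []

  normalForm : (b₁ b₂ b₃ x y z x′ y′ z′ : Carrier) → Fin 4 → Fin 4 → Carrier
  normalForm b₁ b₂ b₃ x y z x′ y′ z′ = matrix (normalFormRows b₁ b₂ b₃ x y z x′ y′ z′)

  -- The last two rows multiplied by x and by y z; u, v, w stand for the products x x′, y y′, z z′
  -- this creates, so that they can be replaced by 1 separately.
  unitDiagonal₃-rescaled : (x y z u v w : Carrier) → Fin 3 → Fin 3 → Carrier
  unitDiagonal₃-rescaled x y z u v w = matrix
    ( (1#    ∷ x     ∷ y     ∷ [])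
    ∷ (u     ∷ x     ∷ x * z ∷ [])
    ∷ (z * v ∷ y * w ∷ y * z ∷ [])
    ∷ [])

  normalForm-rescaled : (b₁ b₂ b₃ x y z u v w : Carrier) → Fin 4 → Fin 4 → Carrier
  normalForm-rescaled b₁ b₂ b₃ x y z u v w = matrix
    ( (1#         ∷ 1#    ∷ 1#    ∷ 1#    ∷ [])
    ∷ (b₁         ∷ 1#    ∷ x     ∷ y     ∷ [])
    ∷ (x * b₂     ∷ u     ∷ x     ∷ x * z ∷ [])
    ∷ (y * z * b₃ ∷ z * v ∷ y * w ∷ y * z ∷ [])
    ∷ [])

-- Det.det recurses through a local helper that cannot be reasoned about for a general size,
-- so these facts are established size by size, by normalising symbolic determinants.
module SmallDeterminants {c ℓ} (R : CommutativeRing c ℓ) where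
  open CommutativeRing R hiding (zero)
  open IntegerRingSolver R
  open Det R
  open Matrices R
  private
    module Poly {m : ℕ} where
      open Det (polynomialRing m) public
      open Matrices (polynomialRing m) public

  entries : ∀ {m n} → (Fin m → Fin n → Carrier) → Vec Carrier (m ℕ.* n)
  entries {n = n} M = tabulate (λ ij → uncurry M (remQuot n ij))

  variables : ∀ {m n} → Fin m → Fin n → Polynomial (m ℕ.* n)
  variables i j = var (combine i j)

  entries-cong : ∀ {m n} {M M′ : Fin m → Fin n → Carrier} →
    (∀ i j → M i j ≈ M′ i j) → Pointwise _≈_ (entries M) (entries M′)
  entries-cong {n = n} M≈M′ = tabulate⁺ (λ ij → uncurry M≈M′ (remQuot n ij))

  det-cong : ∀ k → k ℕ.≤ 4 → ∀ {M M′} → (∀ i j → M i j ≈ M′ i j) → det k M ≈ det k M′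
  det-cong 0 _ M≈M′ = refl
  det-cong 1 _ M≈M′ = ⟦⟧-cong (Poly.det 1 variables) (entries-cong M≈M′)
  det-cong 2 _ M≈M′ = ⟦⟧-cong (Poly.det 2 variables) (entries-cong M≈M′)
  det-cong 3 _ M≈M′ = ⟦⟧-cong (Poly.det 3 variables) (entries-cong M≈M′)
  det-cong 4 _ M≈M′ = ⟦⟧-cong (Poly.det 4 variables) (entries-cong M≈M′)
  det-cong (suc (suc (suc (suc (suc _))))) (s≤s (s≤s (s≤s (s≤s ())))) _

  private
    scalingEntries : ∀ {k} → (Fin k → Carrier) → (Fin k → Fin k → Carrier) → (Fin k → Carrier) →
      Vec Carrier ((2 ℕ.+ k) ℕ.* k)
    scalingEntries l M r = entries λ where
      zero          → l
      (suc zero)    → r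
      (suc (suc i)) → M i

    module _ {k : ℕ} where
      lᵥ rᵥ : Fin k → Polynomial ((2 ℕ.+ k) ℕ.* k)
      lᵥ = variables {2 ℕ.+ k} zero
      rᵥ = variables {2 ℕ.+ k} (suc zero)

      Mᵥ : Fin k → Fin k → Polynomial ((2 ℕ.+ k) ℕ.* k)
      Mᵥ i = variables {2 ℕ.+ k} (suc (suc i))

    scaled unscaled : ∀ k → Polynomial ((2 ℕ.+ k) ℕ.* k)
    scaled   k = Poly.det k (Poly.scale (lᵥ {k}) (Mᵥ {k}) (rᵥ {k}))
    unscaled k = Poly.∏ (λ i → lᵥ {k} i :* rᵥ {k} i) :* Poly.det k (Mᵥ {k})

  det-scale : ∀ k → k ℕ.≤ 4 → ∀ l M r → det k (scale l M r) ≈ ∏ (λ i → l i * r i) * det k M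
  det-scale 0 _ l M r = prove (scalingEntries l M r) (scaled 0) (unscaled 0) refl
  det-scale 1 _ l M r = prove (scalingEntries l M r) (scaled 1) (unscaled 1) refl
  det-scale 2 _ l M r = prove (scalingEntries l M r) (scaled 2) (unscaled 2) refl
  det-scale 3 _ l M r = prove (scalingEntries l M r) (scaled 3) (unscaled 3) refl
  det-scale 4 _ l M r = prove (scalingEntries l M r) (scaled 4) (unscaled 4) refl
  det-scale (suc (suc (suc (suc (suc _))))) (s≤s (s≤s (s≤s (s≤s ()))))

  card-≤ : ∀ {n} (S : Cube n) → card S ℕ.≤ n
  card-≤ []          = z≤n
  card-≤ (true  ∷ S) = s≤s (card-≤ S)
  card-≤ (false ∷ S) = ℕ.m≤n⇒m≤1+n (card-≤ S)

  principalMinor-cong : ∀ {M M′ : Fin 4 → Fin 4 → Carrier} → (∀ i j → M i j ≈ M′ i j) →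
    ∀ S → principalMinor M S ≈ principalMinor M′ S
  principalMinor-cong M≈M′ S = det-cong (card S) (card-≤ S) (λ i j → M≈M′ (elems S i) (elems S j))

  principalMinor-scale : ∀ l (M : Fin 4 → Fin 4 → Carrier) r S →
    principalMinor (scale l M r) S ≈ ∏ (λ i → l (elems S i) * r (elems S i)) * principalMinor M S
  principalMinor-scale l M r S =
    det-scale (card S) (card-≤ S) (l ∘ elems S) (λ i j → M (elems S i) (elems S j)) (r ∘ elems S)

module Invertibility {c ℓ} (R : CommutativeRing c ℓ) where
  open CommutativeRing R hiding (zero)
  open import Relation.Binary.Reasoning.Setoid setoid
  open IntegerRingSolver R using (solve; _:=_; _:*_; :-_)

  Invertible : Carrier → Set _
  Invertible a = ∃ λ b → a * b ≈ 1#

  invertible-1 : Invertible 1#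
  invertible-1 = 1# , *-identityʳ 1#

  invertible-resp : ∀ {a b} → a ≈ b → Invertible a → Invertible b
  invertible-resp a≈b (a⁻¹ , aa⁻¹) = a⁻¹ , trans (*-congʳ (sym a≈b)) aa⁻¹

  invertible-* : ∀ {a b} → Invertible a → Invertible b → Invertible (a * b)
  invertible-* {a} {b} (a⁻¹ , aa⁻¹) (b⁻¹ , bb⁻¹) = a⁻¹ * b⁻¹ , (begin
    a * b * (a⁻¹ * b⁻¹)   ≈⟨ solve 4 (λ a b c d → a :* b :* (c :* d) := (a :* c) :* (b :* d)) refl a b a⁻¹ b⁻¹ ⟩
    (a * a⁻¹) * (b * b⁻¹) ≈⟨ *-cong aa⁻¹ bb⁻¹ ⟩
    1# * 1#               ≈⟨ *-identityˡ 1# ⟩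
    1#                    ∎)

  invertible-factorˡ : ∀ {a b} → Invertible (a * b) → Invertible a
  invertible-factorˡ {a} {b} (c , abc) = b * c , trans (sym (*-assoc a b c)) abc

  invertible-factorʳ : ∀ {a b} → Invertible (a * b) → Invertible b
  invertible-factorʳ {a} {b} = invertible-factorˡ ∘ invertible-resp (*-comm a b)

  invertible-neg : ∀ {a} → Invertible a → Invertible (- a)
  invertible-neg {a} (a⁻¹ , aa⁻¹) = - a⁻¹ , trans (solve 2 (λ a b → :- a :* :- b := a :* b) refl a a⁻¹) aa⁻¹

  invertible⇒≉0 : ¬ 1# ≈ 0# → ∀ {a} → Invertible a → ¬ a ≈ 0#
  invertible⇒≉0 1≉0 {a} (a⁻¹ , aa⁻¹) a≈0 = 1≉0 (begin
    1#         ≈⟨ aa⁻¹ ⟨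
    a * a⁻¹    ≈⟨ *-congʳ a≈0 ⟩
    0# * a⁻¹   ≈⟨ zeroˡ a⁻¹ ⟩
    0#         ∎)

pair : Fin 4 → Fin 4 → Cube 4
pair i j = ⁅ i ⁆ ∪ ⁅ j ⁆

triple : Fin 4 → Fin 4 → Fin 4 → Cube 4
triple i j k = ⁅ i ⁆ ∪ ⁅ j ⁆ ∪ ⁅ k ⁆

full : Cube 4
full = Subset.⊤

module NormalForm {c ℓ} (R : CommutativeRing c ℓ) where
  open CommutativeRing R hiding (zero)
  open IntegerRingSolver R
  open Det R
  open Matrices R
  open Invertibility R
  open import Relation.Binary.Reasoning.Setoid setoid

  private
    module Poly {m : ℕ} where
      open CommutativeRing (polynomialRing m) public using (1#)
      open Det (polynomialRing m) public
      open Matrices (polynomialRing m) public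

  det-unitDiagonal₂ : ∀ a a′ → det 2 (unitDiagonal₂ a a′) ≈ 1# - a * a′
  det-unitDiagonal₂ = solve 2 (λ a a′ → Poly.det 2 (Poly.unitDiagonal₂ a a′) := Poly.1# :- a :* a′) refl

  unitDiagonal₂-vanishing : ∀ {a a′} → det 2 (unitDiagonal₂ a a′) ≈ 0# → a * a′ ≈ 1#
  unitDiagonal₂-vanishing {a} {a′} d≈0 = sym (x∙y⁻¹≈ε⇒x≈y 1# (a * a′) (trans (sym (det-unitDiagonal₂ a a′)) d≈0))
    where open import Algebra.Properties.Ring ring using (x∙y⁻¹≈ε⇒x≈y)

  unitDiagonal₃-cycles : ∀ b b′ t t′ →
    t * b′ + b * t′ ≈ det 3 (unitDiagonal₃ 1# 1# t b b′ t′) + (t * t′ + b + b′ - 1#)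
  unitDiagonal₃-cycles = solve 4 (λ b b′ t t′ →
    t :* b′ :+ b :* t′ :=
    Poly.det 3 (Poly.unitDiagonal₃ Poly.1# Poly.1# t b b′ t′) :+ (t :* t′ :+ b :+ b′ :- Poly.1#)) refl

  unitDiagonal₃-square : ∀ {x y z x′ y′ z′} → x * x′ ≈ 1# → y * y′ ≈ 1# → z * z′ ≈ 1# →
    x * (y * z) * det 3 (unitDiagonal₃ x y z x′ y′ z′) ≈ (x * z - y) * (x * z - y)
  unitDiagonal₃-square {x} {y} {z} {x′} {y′} {z′} xx′ yy′ zz′ = begin
    x * (y * z) * det 3 (unitDiagonal₃ x y z x′ y′ z′)
      ≈⟨ solve 6 (λ x y z x′ y′ z′ →
           x :* (y :* z) :* Poly.det 3 (Poly.unitDiagonal₃ x y z x′ y′ z′) :=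
           Poly.det 3 (Poly.unitDiagonal₃-rescaled x y z (x :* x′) (y :* y′) (z :* z′))) refl x y z x′ y′ z′ ⟩
    det 3 (unitDiagonal₃-rescaled x y z (x * x′) (y * y′) (z * z′))
      ≈⟨ ⟦⟧-cong (Poly.det 3 (Poly.unitDiagonal₃-rescaled (var 0F) (var 1F) (var 2F) (var 3F) (var 4F) (var 5F)))
                 (refl ∷ refl ∷ refl ∷ xx′ ∷ yy′ ∷ zz′ ∷ []) ⟩
    det 3 (unitDiagonal₃-rescaled x y z 1# 1# 1#)
      ≈⟨ solve 3 (λ x y z → Poly.det 3 (Poly.unitDiagonal₃-rescaled x y z Poly.1# Poly.1# Poly.1#) :=
                            (x :* z :- y) :* (x :* z :- y)) refl x y z ⟩
    (x * z - y) * (x * z - y) ∎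

  normalForm-rescaling : ∀ {b₁ b₂ b₃ x y z x′ y′ z′} →
    b₁ ≈ 1# → b₂ ≈ 1# → b₃ ≈ 1# → x * x′ ≈ 1# → y * y′ ≈ 1# → z * z′ ≈ 1# →
    x * (y * z) * det 4 (normalForm b₁ b₂ b₃ x y z x′ y′ z′) ≈
    - ((1# * x - 1#) * ((1# * y - 1#) * ((1# * z - 1#) * (x * z - y))))
  normalForm-rescaling {b₁} {b₂} {b₃} {x} {y} {z} {x′} {y′} {z′} b₁≈1 b₂≈1 b₃≈1 xx′ yy′ zz′ = begin
    x * (y * z) * det 4 (normalForm b₁ b₂ b₃ x y z x′ y′ z′)
      ≈⟨ solve 9 (λ b₁ b₂ b₃ x y z x′ y′ z′ →
           x :* (y :* z) :* Poly.det 4 (Poly.normalForm b₁ b₂ b₃ x y z x′ y′ z′) :=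
           Poly.det 4 (Poly.normalForm-rescaled b₁ b₂ b₃ x y z (x :* x′) (y :* y′) (z :* z′)))
           refl b₁ b₂ b₃ x y z x′ y′ z′ ⟩
    det 4 (normalForm-rescaled b₁ b₂ b₃ x y z (x * x′) (y * y′) (z * z′))
      ≈⟨ ⟦⟧-cong (Poly.det 4 (Poly.normalForm-rescaled (var 0F) (var 1F) (var 2F) (var 3F) (var 4F) (var 5F)
                                                     (var 6F) (var 7F) (var 8F)))
                 (b₁≈1 ∷ b₂≈1 ∷ b₃≈1 ∷ refl ∷ refl ∷ refl ∷ xx′ ∷ yy′ ∷ zz′ ∷ []) ⟩
    det 4 (normalForm-rescaled 1# 1# 1# x y z 1# 1# 1#)
      ≈⟨ solve 3 (λ x y z →
           Poly.det 4 (Poly.normalForm-rescaled Poly.1# Poly.1# Poly.1# x y z Poly.1# Poly.1# Poly.1#) :=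
           :- ((Poly.1# :* x :- Poly.1#) :*
               ((Poly.1# :* y :- Poly.1#) :* ((Poly.1# :* z :- Poly.1#) :* (x :* z :- y)))))
           refl x y z ⟩
    - ((1# * x - 1#) * ((1# * y - 1#) * ((1# * z - 1#) * (x * z - y)))) ∎

  module _ {b₁ b₂ b₃ x y z x′ y′ z′ : Carrier} where
    private
      N : Fin 4 → Fin 4 → Carrier
      N = normalForm b₁ b₂ b₃ x y z x′ y′ z′

    normalForm-det-invertible :
      (∀ S → card S ≡ 2 → principalMinor N S ≈ 0#) →
      (∀ S → card S ≡ 3 → Invertible (principalMinor N S)) →
      Invertible (principalMinor N full)
    normalForm-det-invertible vanishing invertible =
      invertible-factorʳ (invertible-resp (sym (normalForm-rescaling b₁≈1 b₂≈1 b₃≈1 xx′ yy′ zz′))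
        (invertible-neg (invertible-* x-1 (invertible-* y-1 (invertible-* z-1 xz-y)))))
      where
      root-invertible : ∀ {p q r d e} → p * (q * r) * d ≈ e * e →
        Invertible p → Invertible q → Invertible r → Invertible d → Invertible e
      root-invertible eq p⁻¹ q⁻¹ r⁻¹ d⁻¹ =
        invertible-factorˡ (invertible-resp eq (invertible-* (invertible-* p⁻¹ (invertible-* q⁻¹ r⁻¹)) d⁻¹))

      1b₁ : 1# * b₁ ≈ 1#
      1b₁ = unitDiagonal₂-vanishing (vanishing (pair 0F 1F) ≡.refl)
      1b₂ : 1# * b₂ ≈ 1#
      1b₂ = unitDiagonal₂-vanishing (vanishing (pair 0F 2F) ≡.refl)
      1b₃ : 1# * b₃ ≈ 1#
      1b₃ = unitDiagonal₂-vanishing (vanishing (pair 0F 3F) ≡.refl)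
      xx′ : x * x′ ≈ 1#
      xx′ = unitDiagonal₂-vanishing (vanishing (pair 1F 2F) ≡.refl)
      yy′ : y * y′ ≈ 1#
      yy′ = unitDiagonal₂-vanishing (vanishing (pair 1F 3F) ≡.refl)
      zz′ : z * z′ ≈ 1#
      zz′ = unitDiagonal₂-vanishing (vanishing (pair 2F 3F) ≡.refl)

      b₁≈1 : b₁ ≈ 1#
      b₁≈1 = trans (sym (*-identityˡ b₁)) 1b₁
      b₂≈1 : b₂ ≈ 1#
      b₂≈1 = trans (sym (*-identityˡ b₂)) 1b₂
      b₃≈1 : b₃ ≈ 1#
      b₃≈1 = trans (sym (*-identityˡ b₃)) 1b₃

      x-1 : Invertible (1# * x - 1#)
      x-1 = root-invertible (unitDiagonal₃-square 1b₁ 1b₂ xx′) invertible-1 invertible-1 (x′ , xx′)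
              (invertible (triple 0F 1F 2F) ≡.refl)
      y-1 : Invertible (1# * y - 1#)
      y-1 = root-invertible (unitDiagonal₃-square 1b₁ 1b₃ yy′) invertible-1 invertible-1 (y′ , yy′)
              (invertible (triple 0F 1F 3F) ≡.refl)
      z-1 : Invertible (1# * z - 1#)
      z-1 = root-invertible (unitDiagonal₃-square 1b₂ 1b₃ zz′) invertible-1 invertible-1 (z′ , zz′)
              (invertible (triple 0F 2F 3F) ≡.refl)
      xz-y : Invertible (x * z - y)
      xz-y = root-invertible (unitDiagonal₃-square xx′ yy′ zz′) (x′ , xx′) (y′ , yy′) (z′ , zz′)
               (invertible (triple 1F 2F 3F) ≡.refl)

module OrderedField (R : RealField) where
  open RealField R renaming (Carrier to ℝ) public

  ℝ-ring : CommutativeRing _ _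
  ℝ-ring = record { isCommutativeRing = isCommutativeRing }

  open CommutativeRing ℝ-ring public
    using (+-comm; +-identityˡ; +-identityʳ; -‿inverseʳ; semiring; +-commutativeSemigroup)
  open import Algebra.Properties.Ring (CommutativeRing.ring ℝ-ring) public using (x+x≈x⇒x≈0; +-cancelʳ)
  open import Algebra.Properties.Ring (CommutativeRing.ring ℝ-ring) using (-1*x≈-x; -‿involutive)
  open IsTotalOrder isTotalOrder public
    using (total) renaming (refl to ≤-refl; trans to ≤-trans; antisym to ≤-antisym)
  open import Algebra.Properties.Semiring.Mult.TCOptimised semiring public
    using (1+×; ×-homo-+) renaming (_×_ to _·_)

  +-monoʳ-≤ : ∀ a {b c} → b ≤ c → a + b ≤ a + c
  +-monoʳ-≤ a {b} {c} b≤c = subst₂ _≤_ (+-comm b a) (+-comm c a) (+-mono-≤ a b≤c)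

  +-mono-≤′ : ∀ {a b c d} → a ≤ b → c ≤ d → a + c ≤ b + d
  +-mono-≤′ {b = b} {c = c} a≤b c≤d = ≤-trans (+-mono-≤ c a≤b) (+-monoʳ-≤ b c≤d)

  <-≤-trans : ∀ {a b c} → a < b → b ≤ c → a < c
  <-≤-trans (a≤b , a≢b) b≤c = ≤-trans a≤b b≤c , λ { ≡.refl → a≢b (≤-antisym a≤b b≤c) }

  <⇒≱ : ∀ {a b} → a < b → ¬ b ≤ a
  <⇒≱ (a≤b , a≢b) b≤a = a≢b (≤-antisym a≤b b≤a)

  +-monoˡ-< : ∀ c {a b} → a < b → a + c < b + c
  +-monoˡ-< c (a≤b , a≢b) = +-mono-≤ c a≤b , λ eq → a≢b (+-cancelʳ c _ _ eq)

  +-mono-<-≤ : ∀ {a b c d} → a < b → c ≤ d → a + c < b + d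
  +-mono-<-≤ {b = b} {c = c} a<b c≤d = <-≤-trans (+-monoˡ-< c a<b) (+-monoʳ-≤ b c≤d)

  0≤1 : 0r ≤ 1r
  0≤1 with total 0r 1r
  ... | inj₁ 0≤1 = 0≤1
  ... | inj₂ 1≤0 = subst (0r ≤_) -1*-1≡1 (*-nonneg 0≤-1 0≤-1)
    where
    0≤-1 : 0r ≤ - 1r
    0≤-1 = subst₂ _≤_ (-‿inverseʳ 1r) (+-identityˡ (- 1r)) (+-mono-≤ (- 1r) 1≤0)
    -1*-1≡1 : - 1r * - 1r ≡ 1r
    -1*-1≡1 = ≡.trans (-1*x≈-x (- 1r)) (-‿involutive 1r)

  0<1 : 0r < 1r
  0<1 = 0≤1 , 0≢1

  ι : ℕ → ℝ
  ι n = n · 1r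

  0≤ι : ∀ n → 0r ≤ ι n
  0≤ι zero    = ≤-refl
  0≤ι (suc n) = subst₂ _≤_ (+-identityʳ 0r) (≡.sym (1+× n 1r)) (+-mono-≤′ 0≤1 (0≤ι n))

  ι-mono : ∀ {m n} → m ℕ.≤ n → ι m ≤ ι n
  ι-mono {m} m≤n with ℕ.m≤n⇒∃[o]m+o≡n m≤n
  ... | o , ≡.refl = subst₂ _≤_ (+-identityʳ (ι m)) (≡.sym (×-homo-+ 1r m o)) (+-monoʳ-≤ (ι m) (0≤ι o))

module _ {n : ℕ} where
  indicator : Cube n → Vec ℕ n
  indicator = Vec.map (λ b → if b then 1 else 0)

  coordinateSum : List (Cube n) → Vec ℕ n
  coordinateSum = foldr (λ x s → zipWith ℕ._+_ (indicator x) s) (Vec.replicate n 0)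

  Obstruction : (Cube n → ℕ) → Cube n → Cube n → List (Cube n) × List (Cube n) → Set
  Obstruction f x y (zs , xs) =
    1 ℕ.≤ length zs × length zs ≡ length xs ×
    All (λ z → z ≢ x × z ≢ y) zs × All (λ u → u ≡ x ⊎ u ≡ y) xs ×
    coordinateSum zs ≡ coordinateSum xs × sum (map f zs) ℕ.≤ sum (map f xs)

  _≟ᶜ_ : (x y : Cube n) → Dec (x ≡ y)
  _≟ᶜ_ = Vec.≡-dec Bool._≟_

  obstruction? : (f : Cube n → ℕ) (x y : Cube n) → Decidable (Obstruction f x y)
  obstruction? f x y (zs , xs) =
    (1 ℕ.≤? length zs) ×-dec (length zs ℕ.≟ length xs) ×-dec
    All.all? (λ z → ¬? (z ≟ᶜ x) ×-dec ¬? (z ≟ᶜ y)) zs ×-dec All.all? (λ u → (u ≟ᶜ x) ⊎-dec (u ≟ᶜ y)) xs ×-dec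
    Vec.≡-dec ℕ._≟_ (coordinateSum zs) (coordinateSum xs) ×-dec (sum (map f zs) ℕ.≤? sum (map f xs))

cubes : ∀ n → List (Cube n)
cubes zero    = [] ∷ []
cubes (suc n) = map (true ∷_) (cubes n) ++ map (false ∷_) (cubes n)

∈-cubes : ∀ {n} (x : Cube n) → x ∈ cubes n
∈-cubes []          = Any.here ≡.refl
∈-cubes (true  ∷ x) = ∈-++⁺ˡ (∈-map⁺ (true ∷_) (∈-cubes x))
∈-cubes (false ∷ x) = ∈-++⁺ʳ (map (true ∷_) (cubes _)) (∈-map⁺ (false ∷_) (∈-cubes x))

all-cubes? : ∀ {n} {P : Cube n → Set} → Decidable P → Dec (∀ x → P x)
all-cubes? P? = map′ (λ all x → All.lookup all (∈-cubes x)) (λ ∀P → All.tabulate (λ {x} _ → ∀P x))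
                     (All.all? P? (cubes _))

-- Two families of obstructions: the pairs x ⊕ T, y ⊕ T have the midpoint of x and y as their
-- midpoint when T ⊆ x ⊕ y; when x ⊆ y, the points x + e_i (i ∈ y ∖ x) average to a point of [x, y].
candidates : ∀ {n} → Cube n → Cube n → List (List (Cube n) × List (Cube n))
candidates {n} x y = fan x y ∷ fan y x ∷ map swap (cubes n)
  where
  _⊕_ : Cube n → Cube n → Cube n
  _⊕_ = zipWith _xor_

  swap : Cube n → List (Cube n) × List (Cube n)
  swap T = (x ⊕ T ∷ y ⊕ T ∷ [] , x ∷ y ∷ [])

  fan : Cube n → Cube n → List (Cube n) × List (Cube n)
  fan u v = map (λ i → u ⊕ ⁅ i ⁆) (filter (λ i → ¬? (lookup u i Bool.≟ lookup v i)) (allFin n))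
          , v ∷ List.replicate (hamming u v ∸ 1) u

weight : ℕ → ℕ
weight 2 = 1
weight 4 = 1
weight _ = 0

short-or-obstructed : ∀ x y → hamming x y ℕ.≤ 2 ⊎ Any (Obstruction (weight ∘ card) x y) (candidates x y)
short-or-obstructed = toWitness {a? = all-cubes? {4} λ x → all-cubes? λ y →
  (hamming x y ℕ.≤? 2) ⊎-dec Any.any? (obstruction? (weight ∘ card) x y) (candidates x y)} tt

module LowerEdges (R : RealField) where
  open OrderedField R
  open import Algebra.Properties.CommutativeSemigroup +-commutativeSemigroup using (interchange)
  open ≡.≡-Reasoning

  pairing : ∀ {n} → (Fin n → ℝ) → Vec ℕ n → ℝ
  pairing w []      = 0r
  pairing w (k ∷ v) = k · w zero + pairing (w ∘ suc) v

  ⟨⟩-pairing : ∀ {n} (w : Fin n → ℝ) x → ⟨_,_⟩ R w x ≡ pairing w (indicator x)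
  ⟨⟩-pairing w []          = ≡.refl
  ⟨⟩-pairing w (true  ∷ x) = cong (w zero +_) (⟨⟩-pairing (w ∘ suc) x)
  ⟨⟩-pairing w (false ∷ x) = cong (0r +_) (⟨⟩-pairing (w ∘ suc) x)

  pairing-+ : ∀ {n} (w : Fin n → ℝ) u v → pairing w (zipWith ℕ._+_ u v) ≡ pairing w u + pairing w v
  pairing-+ w []      []      = ≡.sym (+-identityʳ 0r)
  pairing-+ w (k ∷ u) (l ∷ v) = begin
    (k ℕ.+ l) · w zero + pairing (w ∘ suc) (zipWith ℕ._+_ u v)
      ≡⟨ cong₂ _+_ (×-homo-+ (w zero) k l) (pairing-+ (w ∘ suc) u v) ⟩
    (k · w zero + l · w zero) + (pairing (w ∘ suc) u + pairing (w ∘ suc) v)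
      ≡⟨ interchange _ _ _ _ ⟩
    (k · w zero + pairing (w ∘ suc) u) + (l · w zero + pairing (w ∘ suc) v) ∎

  pairing-0 : ∀ {n} (w : Fin n → ℝ) → pairing w (Vec.replicate n 0) ≡ 0r
  pairing-0 {zero}  w = ≡.refl
  pairing-0 {suc n} w = ≡.trans (cong (0r +_) (pairing-0 (w ∘ suc))) (+-identityʳ 0r)

  sumOver : ∀ {A : Set} → (A → ℝ) → List A → ℝ
  sumOver F = foldr (λ a s → F a + s) 0r

  module _ {A : Set} (F : A → ℝ) (m : ℝ) where
    sumOver-≤ : ∀ {xs zs} → length zs ≡ length xs →
      All (λ u → F u ≡ m) xs → All (λ z → m < F z) zs → sumOver F xs ≤ sumOver F zs
    sumOver-≤ {[]}     {[]}     _  []           []           = ≤-refl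
    sumOver-≤ {u ∷ xs} {z ∷ zs} eq (Fu≡m ∷ Fxs) (m<Fz ∷ Fzs) =
      +-mono-≤′ (subst (_≤ F z) (≡.sym Fu≡m) (proj₁ m<Fz)) (sumOver-≤ (ℕ.suc-injective eq) Fxs Fzs)

    sumOver-< : ∀ {xs zs} → 1 ℕ.≤ length zs → length zs ≡ length xs →
      All (λ u → F u ≡ m) xs → All (λ z → m < F z) zs → sumOver F xs < sumOver F zs
    sumOver-< {u ∷ xs} {z ∷ zs} _ eq (Fu≡m ∷ Fxs) (m<Fz ∷ Fzs) =
      +-mono-<-≤ (subst (_< F z) (≡.sym Fu≡m) m<Fz) (sumOver-≤ (ℕ.suc-injective eq) Fxs Fzs)

  module _ {n} (f : Cube n → ℕ) (w : Fin n → ℝ) where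
    private
      F : Cube n → ℝ
      F z = ι (f z) + ⟨_,_⟩ R w z

    sumOver-split : ∀ zs → sumOver F zs ≡ ι (sum (map f zs)) + pairing w (coordinateSum zs)
    sumOver-split []       = ≡.sym (≡.trans (cong (0r +_) (pairing-0 w)) (+-identityʳ 0r))
    sumOver-split (z ∷ zs) = begin
      (ι (f z) + ⟨_,_⟩ R w z) + sumOver F zs
        ≡⟨ cong₂ (λ a b → (ι (f z) + a) + b) (⟨⟩-pairing w z) (sumOver-split zs) ⟩
      (ι (f z) + pairing w (indicator z)) + (ι (sum (map f zs)) + pairing w (coordinateSum zs))
        ≡⟨ interchange _ _ _ _ ⟩
      (ι (f z) + ι (sum (map f zs))) + (pairing w (indicator z) + pairing w (coordinateSum zs))
        ≡⟨ cong₂ _+_ (×-homo-+ 1r (f z) _) (pairing-+ w (indicator z) (coordinateSum zs)) ⟨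
      ι (f z ℕ.+ sum (map f zs)) + pairing w (zipWith ℕ._+_ (indicator z) (coordinateSum zs)) ∎

    -- Summing F = p + ⟨ w , _ ⟩ over zs gives more than over xs (termwise, as x and y are the only
    -- minimisers), but the equal coordinate sums make the ⟨ w , _ ⟩ parts agree, so it gives at most as much.
    obstruction⇒¬lowerEdge : ∀ {x y} c → Obstruction f x y c → ¬ IsLowerEdge R (ι ∘ f) w x y
    obstruction⇒¬lowerEdge {x} {y} (zs , xs) (nonempty , same-length , avoiding , endpoints , same-sum , cheaper)
                                             (_ , Fx≡Fy , lower) =
      <⇒≱ (sumOver-< F (F x) nonempty same-length
             (All.map endpoint-value endpoints) (All.map (λ {z} → uncurry (lower z)) avoiding))
          (subst₂ _≤_ (≡.sym (sumOver-split zs)) (≡.sym (sumOver-split xs))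
            (subst (λ v → _ ≤ ι (sum (map f xs)) + pairing w v) same-sum (+-mono-≤ _ (ι-mono cheaper))))
      where
      endpoint-value : ∀ {u} → u ≡ x ⊎ u ≡ y → F u ≡ F x
      endpoint-value (inj₁ ≡.refl) = ≡.refl
      endpoint-value (inj₂ ≡.refl) = ≡.sym Fx≡Fy

module Counterexample (R : RealField) where
  open OrderedField R
  open LowerEdges R

  p : Cube 4 → ℝ
  p S = ι (weight (card S))

  -- Eliminating with `with` would normalise the proof term produced by the decision procedure.
  p-isValuatedΔMatroid : IsValuatedΔMatroid R p
  p-isValuatedΔMatroid w x y edge =
    [ (λ short → short)
    , (λ obstructed → ⊥-elim (uncurry (obstruction⇒¬lowerEdge (weight ∘ card) w) (Any.satisfied obstructed) edge))
    ]′ (short-or-obstructed x y)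

module ExtendedReals (R : RealField) where
  open OrderedField R

  infixl 6 _+ᵥ_
  infix 4 _≤ᵥ_
  _+ᵥ_ : R∞ R → R∞ R → R∞ R
  _+ᵥ_ = _+∞_ R
  _≤ᵥ_ : R∞ R → R∞ R → Set
  _≤ᵥ_ = _≤∞_ R

  Positive : R∞ R → Set
  Positive nothing  = ⊤
  Positive (just r) = 0r < r

  ≤ᵥ-trans : ∀ {u v w} → u ≤ᵥ v → v ≤ᵥ w → u ≤ᵥ w
  ≤ᵥ-trans {w = nothing}               _   _   = tt
  ≤ᵥ-trans {just _} {just _} {just _} u≤v v≤w = ≤-trans u≤v v≤w
  ≤ᵥ-trans {nothing} {just _} {just _} ()  _
  ≤ᵥ-trans {_} {nothing} {just _}      _   ()

  ≤ᵥ-antisym-0 : ∀ {u} → just 0r ≤ᵥ u → u ≤ᵥ just 0r → u ≡ just 0r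
  ≤ᵥ-antisym-0 {just r} 0≤r r≤0 = cong just (≤-antisym r≤0 0≤r)

  positive-≤ : ∀ {u v} → Positive u → u ≤ᵥ v → Positive v
  positive-≤ {v = nothing}     _   _   = tt
  positive-≤ {just _} {just _} 0<u u≤v = <-≤-trans 0<u u≤v

  positive⇒nonneg : ∀ {u} → Positive u → just 0r ≤ᵥ u
  positive⇒nonneg {nothing} _   = tt
  positive⇒nonneg {just _}  0<r = proj₁ 0<r

  ¬positive-0 : ¬ Positive (just 0r)
  ¬positive-0 (_ , 0≢0) = 0≢0 ≡.refl

  nonneg-+ : ∀ {u v} → just 0r ≤ᵥ u → just 0r ≤ᵥ v → just 0r ≤ᵥ u +ᵥ v
  nonneg-+ {just r} {just s} 0≤r 0≤s = subst (_≤ r + s) (+-identityʳ 0r) (+-mono-≤′ 0≤r 0≤s)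
  nonneg-+ {just _} {nothing} _ _    = tt
  nonneg-+ {nothing}          _ _    = tt

  positive-+ : ∀ {u v} → Positive u → just 0r ≤ᵥ v → Positive (u +ᵥ v)
  positive-+ {just r} {just s} 0<r 0≤s = subst (_< r + s) (+-identityʳ 0r) (+-mono-<-≤ 0<r 0≤s)
  positive-+ {just _} {nothing} _ _    = tt
  positive-+ {nothing}          _ _    = tt

  +ᵥ-identityʳ : ∀ u → u +ᵥ just 0r ≡ u
  +ᵥ-identityʳ nothing  = ≡.refl
  +ᵥ-identityʳ (just r) = cong just (+-identityʳ r)

  +ᵥ-identityˡ : ∀ u → just 0r +ᵥ u ≡ u
  +ᵥ-identityˡ nothing  = ≡.refl
  +ᵥ-identityˡ (just r) = cong just (+-identityˡ r)

  nonneg-of-sum-0 : ∀ {u v} → u +ᵥ v ≡ just 0r → v ≤ᵥ u → just 0r ≤ᵥ u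
  nonneg-of-sum-0 {just r} {just s} r+s≡0 s≤r with total 0r r
  ... | inj₁ 0≤r = 0≤r
  ... | inj₂ r≤0 = subst₂ _≤_ (just-injective r+s≡0) (+-identityʳ r) (≤-trans (+-monoʳ-≤ r s≤r) (+-monoʳ-≤ r r≤0))

  double-0 : ∀ {u} → u +ᵥ u ≡ just 0r → u ≡ just 0r
  double-0 {just r} r+r≡0 = ≤ᵥ-antisym-0 0≤r (subst₂ _≤_ (+-identityʳ r) (just-injective r+r≡0) (+-monoʳ-≤ r 0≤r))
    where
    0≤r : 0r ≤ r
    0≤r = nonneg-of-sum-0 {just r} {just r} r+r≡0 ≤-refl

  idempotent⇒0 : ∀ {u} → u +ᵥ u ≡ u → u ≢ nothing → u ≡ just 0r
  idempotent⇒0 {nothing} _  u≢∞ = ⊥-elim (u≢∞ ≡.refl)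
  idempotent⇒0 {just r}  eq _   = cong just (x+x≈x⇒x≈0 r (just-injective eq))

module ValuationRing (R : RealField) {c ℓ} (K : Field c ℓ) (V : Valuation R K) where
  open ExtendedReals R
  open Field K renaming (Carrier to |K|)
  open Valuation V
  open IntegerRingSolver commutativeRing using (solve; _:=_; _:+_; _:-_)
  private module ℝ = OrderedField R

  infix 4 _∈𝒪 _∈𝔪 _∈𝒪ˣ
  _∈𝒪 : |K| → Set
  a ∈𝒪 = just ℝ.0r ≤ᵥ ν a

  _∈𝔪 : |K| → Set
  a ∈𝔪 = Positive (ν a)

  _∈𝒪ˣ : |K| → Set
  a ∈𝒪ˣ = ν a ≡ just ℝ.0r

  ∈𝒪-resp : ∀ {a b} → a ≈ b → a ∈𝒪 → b ∈𝒪
  ∈𝒪-resp a≈b = subst (just ℝ.0r ≤ᵥ_) (ν-cong a≈b)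

  ∈𝔪-resp : ∀ {a b} → a ≈ b → a ∈𝔪 → b ∈𝔪
  ∈𝔪-resp a≈b = subst Positive (ν-cong a≈b)

  ∈𝒪ˣ-resp : ∀ {a b} → a ≈ b → a ∈𝒪ˣ → b ∈𝒪ˣ
  ∈𝒪ˣ-resp a≈b = ≡.trans (≡.sym (ν-cong a≈b))

  ν-1 : ν 1# ≡ just ℝ.0r
  ν-1 = idempotent⇒0 (≡.trans (≡.sym (ν-mult 1# 1#)) (ν-cong (*-identityʳ 1#)))
                     (λ ν1≡∞ → 0≉1 (sym (ν-∞ 1# ν1≡∞)))

  ν-‿ : ∀ a → ν (- a) ≡ ν a
  ν-‿ a = ≡.trans (ν-cong (sym (-1*x≈-x a))) (≡.trans (ν-mult (- 1#) a)
            (≡.trans (cong (_+ᵥ ν a) ν-‿1) (+ᵥ-identityˡ (ν a))))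
    where
    open import Algebra.Properties.Ring ring using (-1*x≈-x; -‿involutive)
    ν-‿1 : ν (- 1#) ≡ just ℝ.0r
    ν-‿1 = double-0 (≡.trans (≡.sym (ν-mult (- 1#) (- 1#)))
                      (≡.trans (ν-cong (trans (-1*x≈-x (- 1#)) (-‿involutive 1#))) ν-1))

  ν-*-∈𝒪ˣ : ∀ {a u} → u ∈𝒪ˣ → ν (a * u) ≡ ν a
  ν-*-∈𝒪ˣ {a} u∈𝒪ˣ = ≡.trans (ν-mult a _) (≡.trans (cong (ν a +ᵥ_) u∈𝒪ˣ) (+ᵥ-identityʳ (ν a)))

  0∈𝔪 : 0# ∈𝔪
  0∈𝔪 = subst Positive (≡.sym ν-0) tt

  ∈𝔪⇒∈𝒪 : ∀ {a} → a ∈𝔪 → a ∈𝒪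
  ∈𝔪⇒∈𝒪 {a} = positive⇒nonneg {ν a}

  ∈𝒪ˣ⇒∈𝒪 : ∀ {a} → a ∈𝒪ˣ → a ∈𝒪
  ∈𝒪ˣ⇒∈𝒪 a∈𝒪ˣ = subst (just ℝ.0r ≤ᵥ_) (≡.sym a∈𝒪ˣ) ℝ.≤-refl

  ∈𝒪ˣ⇒∉𝔪 : ∀ {a} → a ∈𝒪ˣ → ¬ a ∈𝔪
  ∈𝒪ˣ⇒∉𝔪 a∈𝒪ˣ a∈𝔪 = ¬positive-0 (subst Positive a∈𝒪ˣ a∈𝔪)

  ∈𝒪ˣ⇒≉0 : ∀ {a} → a ∈𝒪ˣ → ¬ a ≈ 0#
  ∈𝒪ˣ⇒≉0 a∈𝒪ˣ a≈0 = ∈𝒪ˣ⇒∉𝔪 a∈𝒪ˣ (∈𝔪-resp (sym a≈0) 0∈𝔪)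

  1∈𝒪ˣ : 1# ∈𝒪ˣ
  1∈𝒪ˣ = ν-1

  +-∈𝒪 : ∀ {a b} → a ∈𝒪 → b ∈𝒪 → a + b ∈𝒪
  +-∈𝒪 {a} {b} a∈𝒪 b∈𝒪 with ν-ultra a b
  ... | inj₁ νa≤ = ≤ᵥ-trans {just ℝ.0r} {ν a} {ν (a + b)} a∈𝒪 νa≤
  ... | inj₂ νb≤ = ≤ᵥ-trans {just ℝ.0r} {ν b} {ν (a + b)} b∈𝒪 νb≤

  *-∈𝒪 : ∀ {a b} → a ∈𝒪 → b ∈𝒪 → a * b ∈𝒪
  *-∈𝒪 {a} {b} a∈𝒪 b∈𝒪 = subst (just ℝ.0r ≤ᵥ_) (≡.sym (ν-mult a b)) (nonneg-+ {ν a} {ν b} a∈𝒪 b∈𝒪)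

  -‿∈𝒪 : ∀ {a} → a ∈𝒪 → - a ∈𝒪
  -‿∈𝒪 {a} = subst (just ℝ.0r ≤ᵥ_) (≡.sym (ν-‿ a))

  +-∈𝔪 : ∀ {a b} → a ∈𝔪 → b ∈𝔪 → a + b ∈𝔪
  +-∈𝔪 {a} {b} a∈𝔪 b∈𝔪 with ν-ultra a b
  ... | inj₁ νa≤ = positive-≤ {ν a} a∈𝔪 νa≤
  ... | inj₂ νb≤ = positive-≤ {ν b} b∈𝔪 νb≤

  *-∈𝔪 : ∀ {a b} → a ∈𝔪 → b ∈𝒪 → a * b ∈𝔪
  *-∈𝔪 {a} {b} a∈𝔪 b∈𝒪 = subst Positive (≡.sym (ν-mult a b)) (positive-+ {ν a} {ν b} a∈𝔪 b∈𝒪)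

  -‿∈𝔪 : ∀ {a} → a ∈𝔪 → - a ∈𝔪
  -‿∈𝔪 {a} = subst Positive (≡.sym (ν-‿ a))

  *-∈𝒪ˣ : ∀ {a b} → a ∈𝒪ˣ → b ∈𝒪ˣ → a * b ∈𝒪ˣ
  *-∈𝒪ˣ a∈𝒪ˣ b∈𝒪ˣ = ≡.trans (ν-*-∈𝒪ˣ b∈𝒪ˣ) a∈𝒪ˣ

  ∈𝒪-cancelʳ : ∀ {a u} → u ∈𝒪ˣ → a * u ∈𝒪 → a ∈𝒪
  ∈𝒪-cancelʳ u∈𝒪ˣ = subst (just ℝ.0r ≤ᵥ_) (ν-*-∈𝒪ˣ u∈𝒪ˣ)

  ∈𝒪ˣ-factor : ∀ {a u} → a * u ∈𝒪ˣ → u ∈𝒪ˣ → a ∈𝒪ˣ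
  ∈𝒪ˣ-factor au∈𝒪ˣ u∈𝒪ˣ = ≡.trans (≡.sym (ν-*-∈𝒪ˣ u∈𝒪ˣ)) au∈𝒪ˣ

  private
    a≈[a+b]-b : ∀ a b → a ≈ (a + b) - b
    a≈[a+b]-b = solve 2 (λ a b → a := (a :+ b) :- b) refl

  +-∈𝒪ˣ : ∀ {a b} → a ∈𝒪ˣ → b ∈𝔪 → a + b ∈𝒪ˣ
  +-∈𝒪ˣ {a} {b} a∈𝒪ˣ b∈𝔪 with ν-ultra (a + b) (- b)
  ... | inj₁ ν[a+b]≤ = ≤ᵥ-antisym-0 {ν (a + b)} (+-∈𝒪 (∈𝒪ˣ⇒∈𝒪 a∈𝒪ˣ) (∈𝔪⇒∈𝒪 b∈𝔪))
                         (subst (ν (a + b) ≤ᵥ_) (∈𝒪ˣ-resp (a≈[a+b]-b a b) a∈𝒪ˣ) ν[a+b]≤)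
  ... | inj₂ ν[-b]≤ = ⊥-elim (¬positive-0 (positive-≤ {ν (- b)} (-‿∈𝔪 b∈𝔪)
                         (subst (ν (- b) ≤ᵥ_) (∈𝒪ˣ-resp (a≈[a+b]-b a b) a∈𝒪ˣ) ν[-b]≤)))

  -- Writing a = (a + b) - b, either ν a ≥ ν (a + b) ≥ 0 or ν a ≥ ν b = - ν a.
  summand-∈𝒪 : ∀ {a b} → a * b ∈𝒪ˣ → a + b ∈𝒪 → a ∈𝒪
  summand-∈𝒪 {a} {b} ab∈𝒪ˣ a+b∈𝒪 with ν-ultra (a + b) (- b)
  ... | inj₁ ν[a+b]≤ = ≤ᵥ-trans {just ℝ.0r} {ν (a + b)} {ν a} a+b∈𝒪
                         (subst (ν (a + b) ≤ᵥ_) (≡.sym (ν-cong (a≈[a+b]-b a b))) ν[a+b]≤)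
  ... | inj₂ ν[-b]≤ = nonneg-of-sum-0 {ν a} {ν b} (≡.trans (≡.sym (ν-mult a b)) ab∈𝒪ˣ)
                         (subst₂ _≤ᵥ_ (ν-‿ b) (≡.sym (ν-cong (a≈[a+b]-b a b))) ν[-b]≤)

  ∏-∈𝒪ˣ : ∀ {k} (f : Fin k → |K|) → (∀ i → f i ∈𝒪ˣ) → Matrices.∏ commutativeRing f ∈𝒪ˣ
  ∏-∈𝒪ˣ {zero}  f f∈𝒪ˣ = 1∈𝒪ˣ
  ∏-∈𝒪ˣ {suc k} f f∈𝒪ˣ = *-∈𝒪ˣ (f∈𝒪ˣ 0F) (∏-∈𝒪ˣ (f ∘ suc) (f∈𝒪ˣ ∘ suc))

module ResidueRing (R : RealField) {c ℓ} (K : Field c ℓ) (V : Valuation R K) where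
  open ValuationRing R K V
  open Field K renaming (Carrier to |K|)
  open IntegerRingSolver commutativeRing using (solve; _:=_; _:+_; _:*_; _:-_; :-_)
  open import Algebra.Properties.Ring ring using (x≈y⇒x∙y⁻¹≈ε; -0#≈0#)

  𝒪 : Set _
  𝒪 = Σ |K| _∈𝒪

  infix 4 _≋_
  _≋_ : |K| → |K| → Set
  a ≋ b = a - b ∈𝔪

  ≈⇒≋ : ∀ {a b} → a ≈ b → a ≋ b
  ≈⇒≋ a≈b = ∈𝔪-resp (sym (x≈y⇒x∙y⁻¹≈ε a≈b)) 0∈𝔪

  ∈𝔪⇒≋0 : ∀ {a} → a ∈𝔪 → a ≋ 0#
  ∈𝔪⇒≋0 {a} = ∈𝔪-resp (sym (trans (+-congˡ -0#≈0#) (+-identityʳ a)))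

  1≉0-mod-𝔪 : ¬ 1# ≋ 0#
  1≉0-mod-𝔪 1-0∈𝔪 = ∈𝒪ˣ⇒∉𝔪 1∈𝒪ˣ (∈𝔪-resp (trans (+-congˡ -0#≈0#) (+-identityʳ 1#)) 1-0∈𝔪)

  -- 𝒪/𝔪 is modelled by 𝒪 itself, with congruence modulo 𝔪 as equality.
  residueRing : CommutativeRing _ _
  residueRing = record
    { Carrier = 𝒪
    ; _≈_ = λ a b → proj₁ a ≋ proj₁ b
    ; _+_ = λ a b → proj₁ a + proj₁ b , +-∈𝒪 (proj₂ a) (proj₂ b)
    ; _*_ = λ a b → proj₁ a * proj₁ b , *-∈𝒪 (proj₂ a) (proj₂ b)
    ; -_  = λ a → - proj₁ a , -‿∈𝒪 (proj₂ a)
    ; 0#  = 0# , ∈𝔪⇒∈𝒪 0∈𝔪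
    ; 1#  = 1# , ∈𝒪ˣ⇒∈𝒪 1∈𝒪ˣ
    ; isCommutativeRing = record
      { isRing = record
        { +-isAbelianGroup = record
          { isGroup = record
            { isMonoid = record
              { isSemigroup = record
                { isMagma = record
                  { isEquivalence = record
                    { refl  = ≈⇒≋ refl
                    ; sym   = λ {a} {b} a≋b → ∈𝔪-resp (difference-sym (proj₁ a) (proj₁ b)) (-‿∈𝔪 a≋b)
                    ; trans = λ {a} {b} {c} a≋b b≋c →
                        ∈𝔪-resp (difference-trans (proj₁ a) (proj₁ b) (proj₁ c)) (+-∈𝔪 a≋b b≋c)
                    }
                  ; ∙-cong = λ {a} {b} {c} {d} a≋b c≋d →
                      ∈𝔪-resp (difference-+ (proj₁ a) (proj₁ b) (proj₁ c) (proj₁ d)) (+-∈𝔪 a≋b c≋d)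
                  }
                ; assoc = λ a b c → ≈⇒≋ (+-assoc (proj₁ a) (proj₁ b) (proj₁ c))
                }
              ; identity = (λ a → ≈⇒≋ (+-identityˡ (proj₁ a))) , (λ a → ≈⇒≋ (+-identityʳ (proj₁ a)))
              }
            ; inverse = (λ a → ≈⇒≋ (-‿inverseˡ (proj₁ a))) , (λ a → ≈⇒≋ (-‿inverseʳ (proj₁ a)))
            ; ⁻¹-cong = λ {a} {b} a≋b → ∈𝔪-resp (difference-‿ (proj₁ a) (proj₁ b)) (-‿∈𝔪 a≋b)
            }
          ; comm = λ a b → ≈⇒≋ (+-comm (proj₁ a) (proj₁ b))
          }
        ; *-cong = λ {a} {b} {c} {d} a≋b c≋d →
            ∈𝔪-resp (difference-* (proj₁ a) (proj₁ b) (proj₁ c) (proj₁ d))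
                    (+-∈𝔪 (*-∈𝔪 a≋b (proj₂ c)) (*-∈𝔪 c≋d (proj₂ b)))
        ; *-assoc = λ a b c → ≈⇒≋ (*-assoc (proj₁ a) (proj₁ b) (proj₁ c))
        ; *-identity = (λ a → ≈⇒≋ (*-identityˡ (proj₁ a))) , (λ a → ≈⇒≋ (*-identityʳ (proj₁ a)))
        ; distrib = (λ a b c → ≈⇒≋ (distribˡ (proj₁ a) (proj₁ b) (proj₁ c)))
                  , (λ a b c → ≈⇒≋ (distribʳ (proj₁ a) (proj₁ b) (proj₁ c)))
        }
      ; *-comm = λ a b → ≈⇒≋ (*-comm (proj₁ a) (proj₁ b))
      }
    }
    where
    difference-sym : ∀ a b → - (a - b) ≈ b - a
    difference-sym = solve 2 (λ a b → :- (a :- b) := b :- a) refl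
    difference-trans : ∀ a b c → (a - b) + (b - c) ≈ a - c
    difference-trans = solve 3 (λ a b c → (a :- b) :+ (b :- c) := a :- c) refl
    difference-+ : ∀ a b c d → (a - b) + (c - d) ≈ (a + c) - (b + d)
    difference-+ = solve 4 (λ a b c d → (a :- b) :+ (c :- d) := (a :+ c) :- (b :+ d)) refl
    difference-‿ : ∀ a b → - (a - b) ≈ - a - - b
    difference-‿ = solve 2 (λ a b → :- (a :- b) := :- a :- :- b) refl
    difference-* : ∀ a b c d → (a - b) * c + (c - d) * b ≈ a * c - b * d
    difference-* = solve 4 (λ a b c d → (a :- b) :* c :+ (c :- d) :* b := a :* c :- b :* d) refl

  open Invertibility residueRing public using () renaming (Invertible to Invertible-mod-𝔪)

  ∈𝒪ˣ⇒invertible : ∀ (a : 𝒪) → proj₁ a ∈𝒪ˣ → Invertible-mod-𝔪 a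
  ∈𝒪ˣ⇒invertible (a , _) a∈𝒪ˣ with inverse a (∈𝒪ˣ⇒≉0 a∈𝒪ˣ)
  ... | a⁻¹ , aa⁻¹≈1 = (a⁻¹ , ∈𝒪ˣ⇒∈𝒪 a⁻¹∈𝒪ˣ) , ≈⇒≋ aa⁻¹≈1
    where
    a⁻¹∈𝒪ˣ : a⁻¹ ∈𝒪ˣ
    a⁻¹∈𝒪ˣ = ∈𝒪ˣ-factor (∈𝒪ˣ-resp (trans (sym aa⁻¹≈1) (*-comm a a⁻¹)) 1∈𝒪ˣ) a∈𝒪ˣ

  private
    module K̄ = Det residueRing

  residue-det : ∀ k → k ℕ.≤ 4 → ∀ M → proj₁ (K̄.det k M) ≡ Det.det commutativeRing k (λ i j → proj₁ (M i j))
  residue-det 0 _ M = ≡.refl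
  residue-det 1 _ M = ≡.refl
  residue-det 2 _ M = ≡.refl
  residue-det 3 _ M = ≡.refl
  residue-det 4 _ M = ≡.refl
  residue-det (suc (suc (suc (suc (suc _))))) (s≤s (s≤s (s≤s (s≤s ()))))

  residue-minor : ∀ (M̄ : Fin 4 → Fin 4 → 𝒪) {M} → (∀ i j → proj₁ (M̄ i j) ≡ M i j) →
    ∀ S → proj₁ (K̄.principalMinor M̄ S) ≈ Det.principalMinor commutativeRing M S
  residue-minor M̄ M̄≡M S = trans (reflexive (residue-det (card S) (card-≤ S) _))
                                  (principalMinor-cong (λ i j → reflexive (M̄≡M i j)) S)
    where open SmallDeterminants commutativeRing using (card-≤; principalMinor-cong)

module Realisations (R : RealField) {c ℓ} (K : Field c ℓ) (V : Valuation R K) where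
  open ValuationRing R K V
  open ResidueRing R K V
  open Field K renaming (Carrier to |K|)
  open Valuation V
  open IntegerRingSolver commutativeRing using (solve; _:=_; _:+_; _:*_; _:-_; :-_)
  open Det commutativeRing
  open Matrices commutativeRing
  open SmallDeterminants commutativeRing using (principalMinor-cong; principalMinor-scale)
  open NormalForm commutativeRing using (det-unitDiagonal₂; unitDiagonal₃-cycles)
  open Counterexample R using (p)
  open import Relation.Binary.Reasoning.Setoid setoid
  private
    module ℝ = OrderedField R
    module K̄ where
      open Invertibility residueRing public using (invertible⇒≉0)
      open Det residueRing public
      open Matrices residueRing public
      open NormalForm residueRing public using (normalForm-det-invertible)

  Realises : (Fin 4 → Fin 4 → |K|) → Set
  Realises A = ∀ S → ν (principalMinor A S) ≡ just (p S)

  module _ {A : Fin 4 → Fin 4 → |K|} (realises : Realises A) where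
    realised-∈𝔪 : ∀ S → weight (card S) ≡ 1 → principalMinor A S ∈𝔪
    realised-∈𝔪 S w≡1 = subst Positive (≡.sym (≡.trans (realises S) (cong (just ∘ ℝ.ι) w≡1))) ℝ.0<1
      where open ExtendedReals R using (Positive)

    realised-∈𝒪ˣ : ∀ S → weight (card S) ≡ 0 → principalMinor A S ∈𝒪ˣ
    realised-∈𝒪ˣ S w≡0 = ≡.trans (realises S) (cong (just ∘ ℝ.ι) w≡0)

  off-diagonal-product-∈𝒪ˣ : ∀ {a a′} → det 2 (unitDiagonal₂ a a′) ∈𝔪 → a * a′ ∈𝒪ˣ
  off-diagonal-product-∈𝒪ˣ {a} {a′} d∈𝔪 = ∈𝒪ˣ-resp (begin
    1# + - det 2 (unitDiagonal₂ a a′) ≈⟨ +-congˡ (-‿cong (det-unitDiagonal₂ a a′)) ⟩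
    1# + - (1# - a * a′)              ≈⟨ solve 2 (λ one u → one :+ :- (one :- u) := u) refl 1# (a * a′) ⟩
    a * a′                            ∎) (+-∈𝒪ˣ 1∈𝒪ˣ (-‿∈𝔪 d∈𝔪))

  corner-entries-∈𝒪 : ∀ {b b′ t t′} → b ∈𝒪ˣ → b′ ∈𝒪ˣ → t * t′ ∈𝒪ˣ →
    det 3 (unitDiagonal₃ 1# 1# t b b′ t′) ∈𝒪 → t ∈𝒪 × t′ ∈𝒪
  corner-entries-∈𝒪 {b} {b′} {t} {t′} b∈𝒪ˣ b′∈𝒪ˣ tt′∈𝒪ˣ d∈𝒪 =
    ∈𝒪-cancelʳ b′∈𝒪ˣ (summand-∈𝒪 cycles∈𝒪ˣ sum∈𝒪) ,
    ∈𝒪-cancelʳ b∈𝒪ˣ (∈𝒪-resp (*-comm b t′)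
                      (summand-∈𝒪 (∈𝒪ˣ-resp (*-comm _ _) cycles∈𝒪ˣ) (∈𝒪-resp (+-comm _ _) sum∈𝒪)))
    where
    cycles∈𝒪ˣ : t * b′ * (b * t′) ∈𝒪ˣ
    cycles∈𝒪ˣ = ∈𝒪ˣ-resp (solve 4 (λ b b′ t t′ → t :* t′ :* (b :* b′) := t :* b′ :* (b :* t′)) refl b b′ t t′)
                         (*-∈𝒪ˣ tt′∈𝒪ˣ (*-∈𝒪ˣ b∈𝒪ˣ b′∈𝒪ˣ))

    sum∈𝒪 : t * b′ + b * t′ ∈𝒪
    sum∈𝒪 = ∈𝒪-resp (sym (unitDiagonal₃-cycles b b′ t t′))
              (+-∈𝒪 d∈𝒪 (+-∈𝒪 (+-∈𝒪 (+-∈𝒪 (∈𝒪ˣ⇒∈𝒪 tt′∈𝒪ˣ) (∈𝒪ˣ⇒∈𝒪 b∈𝒪ˣ)) (∈𝒪ˣ⇒∈𝒪 b′∈𝒪ˣ))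
                                (-‿∈𝒪 (∈𝒪ˣ⇒∈𝒪 1∈𝒪ˣ))))

  module RealisedNormalForm {b₁ b₂ b₃ x y z x′ y′ z′ : |K|}
                            (realises : Realises (normalForm b₁ b₂ b₃ x y z x′ y′ z′)) where
    N : Fin 4 → Fin 4 → |K|
    N = normalForm b₁ b₂ b₃ x y z x′ y′ z′

    minor-∈𝔪 : ∀ S → weight (card S) ≡ 1 → principalMinor N S ∈𝔪
    minor-∈𝔪 = realised-∈𝔪 {N} realises

    minor-∈𝒪ˣ : ∀ S → weight (card S) ≡ 0 → principalMinor N S ∈𝒪ˣ
    minor-∈𝒪ˣ = realised-∈𝒪ˣ {N} realises

    b₁∈𝒪ˣ : b₁ ∈𝒪ˣ
    b₁∈𝒪ˣ = ∈𝒪ˣ-resp (*-identityˡ b₁) (off-diagonal-product-∈𝒪ˣ {1#} (minor-∈𝔪 (pair 0F 1F) ≡.refl))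
    b₂∈𝒪ˣ : b₂ ∈𝒪ˣ
    b₂∈𝒪ˣ = ∈𝒪ˣ-resp (*-identityˡ b₂) (off-diagonal-product-∈𝒪ˣ {1#} (minor-∈𝔪 (pair 0F 2F) ≡.refl))
    b₃∈𝒪ˣ : b₃ ∈𝒪ˣ
    b₃∈𝒪ˣ = ∈𝒪ˣ-resp (*-identityˡ b₃) (off-diagonal-product-∈𝒪ˣ {1#} (minor-∈𝔪 (pair 0F 3F) ≡.refl))
    xx′∈𝒪ˣ : x * x′ ∈𝒪ˣ
    xx′∈𝒪ˣ = off-diagonal-product-∈𝒪ˣ {x} (minor-∈𝔪 (pair 1F 2F) ≡.refl)
    yy′∈𝒪ˣ : y * y′ ∈𝒪ˣ
    yy′∈𝒪ˣ = off-diagonal-product-∈𝒪ˣ {y} (minor-∈𝔪 (pair 1F 3F) ≡.refl)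
    zz′∈𝒪ˣ : z * z′ ∈𝒪ˣ
    zz′∈𝒪ˣ = off-diagonal-product-∈𝒪ˣ {z} (minor-∈𝔪 (pair 2F 3F) ≡.refl)

    x,x′∈𝒪 : x ∈𝒪 × x′ ∈𝒪
    x,x′∈𝒪 = corner-entries-∈𝒪 b₁∈𝒪ˣ b₂∈𝒪ˣ xx′∈𝒪ˣ (∈𝒪ˣ⇒∈𝒪 (minor-∈𝒪ˣ (triple 0F 1F 2F) ≡.refl))
    y,y′∈𝒪 : y ∈𝒪 × y′ ∈𝒪
    y,y′∈𝒪 = corner-entries-∈𝒪 b₁∈𝒪ˣ b₃∈𝒪ˣ yy′∈𝒪ˣ (∈𝒪ˣ⇒∈𝒪 (minor-∈𝒪ˣ (triple 0F 1F 3F) ≡.refl))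
    z,z′∈𝒪 : z ∈𝒪 × z′ ∈𝒪
    z,z′∈𝒪 = corner-entries-∈𝒪 b₂∈𝒪ˣ b₃∈𝒪ˣ zz′∈𝒪ˣ (∈𝒪ˣ⇒∈𝒪 (minor-∈𝒪ˣ (triple 0F 2F 3F) ≡.refl))

    b̄₁ b̄₂ b̄₃ x̄ ȳ z̄ x̄′ ȳ′ z̄′ : 𝒪
    b̄₁ = b₁ , ∈𝒪ˣ⇒∈𝒪 b₁∈𝒪ˣ
    b̄₂ = b₂ , ∈𝒪ˣ⇒∈𝒪 b₂∈𝒪ˣ
    b̄₃ = b₃ , ∈𝒪ˣ⇒∈𝒪 b₃∈𝒪ˣ
    x̄  = x  , proj₁ x,x′∈𝒪
    ȳ  = y  , proj₁ y,y′∈𝒪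
    z̄  = z  , proj₁ z,z′∈𝒪
    x̄′ = x′ , proj₂ x,x′∈𝒪
    ȳ′ = y′ , proj₂ y,y′∈𝒪
    z̄′ = z′ , proj₂ z,z′∈𝒪

    N̄ : Fin 4 → Fin 4 → 𝒪
    N̄ = K̄.normalForm b̄₁ b̄₂ b̄₃ x̄ ȳ z̄ x̄′ ȳ′ z̄′

    reduction : ∀ S → proj₁ (K̄.principalMinor N̄ S) ≈ principalMinor N S
    reduction = residue-minor N̄ (matrix-map proj₁ (K̄.normalFormRows b̄₁ b̄₂ b̄₃ x̄ ȳ z̄ x̄′ ȳ′ z̄′))

    det-invertible : Invertible-mod-𝔪 (K̄.principalMinor N̄ full)
    det-invertible = K̄.normalForm-det-invertible {b̄₁} {b̄₂} {b̄₃} {x̄} {ȳ} {z̄} {x̄′} {ȳ′} {z̄′}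
      (λ S card≡2 → ∈𝔪⇒≋0 {proj₁ (K̄.principalMinor N̄ S)}
                      (∈𝔪-resp (sym (reduction S)) (minor-∈𝔪 S (cong weight card≡2))))
      (λ S card≡3 → ∈𝒪ˣ⇒invertible (K̄.principalMinor N̄ S)
                      (∈𝒪ˣ-resp (sym (reduction S)) (minor-∈𝒪ˣ S (cong weight card≡3))))

    det≋0 : proj₁ (K̄.principalMinor N̄ full) ≋ 0#
    det≋0 = ∈𝔪⇒≋0 {proj₁ (K̄.principalMinor N̄ full)} (∈𝔪-resp (sym (reduction full)) (minor-∈𝔪 full ≡.refl))

  normalForm-not-realisable : ∀ {b₁ b₂ b₃ x y z x′ y′ z′} → ¬ Realises (normalForm b₁ b₂ b₃ x y z x′ y′ z′)
  normalForm-not-realisable realises =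
    K̄.invertible⇒≉0 1≉0-mod-𝔪 {K̄.principalMinor N̄ full} det-invertible det≋0
    where open RealisedNormalForm realises

  off-diagonal-≉0 : ∀ (M : Fin 2 → Fin 2 → |K|) → det 2 M ∈𝔪 → M 0F 0F ∈𝒪ˣ → M 1F 1F ∈𝒪ˣ → ¬ M 0F 1F ≈ 0#
  off-diagonal-≉0 M d∈𝔪 m₀₀∈𝒪ˣ m₁₁∈𝒪ˣ m₀₁≈0 = ∈𝒪ˣ⇒∉𝔪 (∈𝒪ˣ-resp diagonal≈det (*-∈𝒪ˣ m₀₀∈𝒪ˣ m₁₁∈𝒪ˣ)) d∈𝔪
    where
    open import Algebra.Properties.Ring ring using (-0#≈0#)
    diagonal≈det : M 0F 0F * M 1F 1F ≈ det 2 M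
    diagonal≈det = begin
      M 0F 0F * M 1F 1F                                        ≈⟨ *-congˡ (*-identityʳ _) ⟨
      M 0F 0F * (M 1F 1F * 1#)                                 ≈⟨ +-identityʳ _ ⟨
      M 0F 0F * (M 1F 1F * 1#) + 0#                            ≈⟨ +-congˡ -0#≈0# ⟨
      M 0F 0F * (M 1F 1F * 1#) + - 0#                          ≈⟨ +-congˡ (-‿cong (trans (*-congʳ m₀₁≈0) (zeroˡ _))) ⟨
      M 0F 0F * (M 1F 1F * 1#) + - (M 0F 1F * (M 1F 0F * 1#)) ∎

  module Normalisation {A : Fin 4 → Fin 4 → |K|} (realises : Realises A) where
    private
      submatrix : (S : Cube 4) → Fin (card S) → Fin (card S) → |K|
      submatrix S i j = A (elems S i) (elems S j)

      inv : ∀ a → ¬ a ≈ 0# → |K|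
      inv a a≉0 = proj₁ (inverse a a≉0)

      inv-law : ∀ a a≉0 → a * inv a a≉0 ≈ 1#
      inv-law a a≉0 = proj₂ (inverse a a≉0)

    diagonal-∈𝒪ˣ : ∀ i → A i i ∈𝒪ˣ
    diagonal-∈𝒪ˣ 0F = ∈𝒪ˣ-resp (*-identityʳ _) (realised-∈𝒪ˣ {A} realises ⁅ 0F ⁆ ≡.refl)
    diagonal-∈𝒪ˣ 1F = ∈𝒪ˣ-resp (*-identityʳ _) (realised-∈𝒪ˣ {A} realises ⁅ 1F ⁆ ≡.refl)
    diagonal-∈𝒪ˣ 2F = ∈𝒪ˣ-resp (*-identityʳ _) (realised-∈𝒪ˣ {A} realises ⁅ 2F ⁆ ≡.refl)
    diagonal-∈𝒪ˣ 3F = ∈𝒪ˣ-resp (*-identityʳ _) (realised-∈𝒪ˣ {A} realises ⁅ 3F ⁆ ≡.refl)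

    first-row-≉0 : ∀ j → ¬ A 0F (suc j) ≈ 0#
    first-row-≉0 0F = off-diagonal-≉0 (submatrix (pair 0F 1F)) (realised-∈𝔪 {A} realises (pair 0F 1F) ≡.refl)
                                      (diagonal-∈𝒪ˣ 0F) (diagonal-∈𝒪ˣ 1F)
    first-row-≉0 1F = off-diagonal-≉0 (submatrix (pair 0F 2F)) (realised-∈𝔪 {A} realises (pair 0F 2F) ≡.refl)
                                      (diagonal-∈𝒪ˣ 0F) (diagonal-∈𝒪ˣ 2F)
    first-row-≉0 2F = off-diagonal-≉0 (submatrix (pair 0F 3F)) (realised-∈𝔪 {A} realises (pair 0F 3F) ≡.refl)
                                      (diagonal-∈𝒪ˣ 0F) (diagonal-∈𝒪ˣ 3F)

    l r : Fin 4 → |K|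
    l 0F      = 1#
    l (suc j) = A 0F (suc j) * inv (A (suc j) (suc j)) (∈𝒪ˣ⇒≉0 (diagonal-∈𝒪ˣ (suc j)))
    r 0F      = inv (A 0F 0F) (∈𝒪ˣ⇒≉0 (diagonal-∈𝒪ˣ 0F))
    r (suc j) = inv (A 0F (suc j)) (first-row-≉0 j)

    N : Fin 4 → Fin 4 → |K|
    N = scale l A r

    N-first-row : ∀ j → N 0F (suc j) ≈ 1#
    N-first-row j = trans (*-congʳ (*-identityˡ _)) (inv-law _ _)

    N-diagonal : ∀ i → N i i ≈ 1#
    N-diagonal 0F      = trans (*-congʳ (*-identityˡ _)) (inv-law _ _)
    N-diagonal (suc j) = begin
      a * d⁻¹ * d * a⁻¹
        ≈⟨ solve 4 (λ a d⁻¹ d a⁻¹ → a :* d⁻¹ :* d :* a⁻¹ := (a :* a⁻¹) :* (d :* d⁻¹)) refl a d⁻¹ d a⁻¹ ⟩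
      (a * a⁻¹) * (d * d⁻¹) ≈⟨ *-cong (inv-law _ _) (inv-law _ _) ⟩
      1# * 1#               ≈⟨ *-identityˡ 1# ⟩
      1#                    ∎
      where
      a a⁻¹ d d⁻¹ : |K|
      a   = A 0F (suc j)
      a⁻¹ = r (suc j)
      d   = A (suc j) (suc j)
      d⁻¹ = inv d (∈𝒪ˣ⇒≉0 (diagonal-∈𝒪ˣ (suc j)))

    lr∈𝒪ˣ : ∀ i → l i * r i ∈𝒪ˣ
    lr∈𝒪ˣ i = ∈𝒪ˣ-factor (∈𝒪ˣ-resp (trans (sym (N-diagonal i)) (rearrange (l i) (A i i) (r i))) 1∈𝒪ˣ) (diagonal-∈𝒪ˣ i)
      where
      rearrange : ∀ u a v → u * a * v ≈ u * v * a
      rearrange = solve 3 (λ u a v → u :* a :* v := u :* v :* a) refl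

    N-realises : Realises N
    N-realises S = ≡.trans (ν-cong (trans (principalMinor-scale l A r S) (*-comm _ _)))
                     (≡.trans (ν-*-∈𝒪ˣ (∏-∈𝒪ˣ _ (λ i → lr∈𝒪ˣ (elems S i)))) (realises S))

    N′ : Fin 4 → Fin 4 → |K|
    N′ = normalForm (N 1F 0F) (N 2F 0F) (N 3F 0F) (N 1F 2F) (N 1F 3F) (N 2F 3F) (N 2F 1F) (N 3F 1F) (N 3F 2F)

    N′≈N : ∀ i j → N′ i j ≈ N i j
    N′≈N 0F 0F = sym (N-diagonal 0F)
    N′≈N 0F 1F = sym (N-first-row 0F)
    N′≈N 0F 2F = sym (N-first-row 1F)
    N′≈N 0F 3F = sym (N-first-row 2F)
    N′≈N 1F 1F = sym (N-diagonal 1F)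
    N′≈N 2F 2F = sym (N-diagonal 2F)
    N′≈N 3F 3F = sym (N-diagonal 3F)
    N′≈N 1F 0F = refl
    N′≈N 1F 2F = refl
    N′≈N 1F 3F = refl
    N′≈N 2F 0F = refl
    N′≈N 2F 1F = refl
    N′≈N 2F 3F = refl
    N′≈N 3F 0F = refl
    N′≈N 3F 1F = refl
    N′≈N 3F 2F = refl

    normalForm-realises : Realises N′
    normalForm-realises S = ≡.trans (ν-cong (principalMinor-cong N′≈N S)) (N-realises S)

  not-realisable : ¬ ∃ Realises
  not-realisable (A , realises) = normalForm-not-realisable (Normalisation.normalForm-realises {A} realises)

corollary6p10 : (R : RealField) {c ℓ : Level} (K : Field c ℓ) (V : Valuation R K) →
    ∃ λ (p : Cube 4 → RealField.Carrier R) →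
      IsValuatedΔMatroid R p × (p ∅ ≡ RealField.0r R) ×
      ¬ (∃ λ (A : Fin 4 → Fin 4 → Field.Carrier K) →
           ∀ (S : Cube 4) →
             Valuation.ν V (Det.principalMinor (Field.commutativeRing K) A S) ≡ just (p S))
corollary6p10 R K V = p , p-isValuatedΔMatroid , ≡.refl , not-realisable
  where
  open Counterexample R using (p; p-isValuatedΔMatroid)
  open Realisations R K V using (not-realisable)
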